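{- Assume the $abc$-conjecture. Then for every integer $k \ge 3$ and every real $\epsilon > 0$ there is a constant $C = C(k,\epsilon) > 0$ such that for all real $x \ge 1$ and all real $y$ with $1 \le y \le x$, \[ Q_k(x + y) - Q_k(x) \le C\, y^{(2 + \epsilon)/k}. \]
   Context: For an integer $k \ge 2$, a positive integer $n$ is $k$-full if every prime $p$ dividing $n$ satisfies $p^k \mid n$; $Q_k(x)$ denotes the number of $k$-full positive integers $n \le x$. For a nonzero integer $m$, $\kappa(m) = \prod_{p \mid m} p$ (product over distinct primes dividing $m$). The $abc$-conjecture is the statement: for every $\epsilon > 0$ there is a constant $C_\epsilon > 0$ such that for all integers $a, b, c$ with $a + b = c$ and $\gcd(a,b) = 1$, one has $\max\{|a|,|b|,|c|\} \le C_\epsilon\, \kappa(abc)^{1+\epsilon}$.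
   Formalization: The numbers $x$, $y$ and $\epsilon$ range only over the rationals rather than the reals, and the $\epsilon$ of the $abc$-conjecture is likewise taken in the positive rationals. -}

module Defs where

open import Data.Nat as ℕ using (ℕ; zero; suc; _⊔_)
open import Data.Nat.Divisibility using (_∣_; _∣?_)
open import Data.Nat.Primality using (Prime; prime?)
open import Data.Nat.Coprimality using (Coprime)
open import Data.Integer as ℤ using (ℤ; +_; ∣_∣)
open import Data.Rational as ℚ using (ℚ; _/_)
open import Data.List using (List; filter; upTo; length)
open import Data.Nat.ListAction using (product)
open import Data.List.Relation.Unary.All using (All)
open import Data.List.Relation.Unary.Unique.Propositional using (Unique)
open import Data.Product using (∃; _×_)
open import Relation.Nullary.Decidable using (_×-dec_)
open import Relation.Nullary using (¬_)
open import Relation.Binary.PropositionalEquality using (_≡_)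

KFull : ℕ → ℕ → Set
KFull k n = ∀ (p : ℕ) → Prime p → p ∣ n → (p ℕ.^ k) ∣ n

-- κ(m) = product of the distinct primes dividing m (for m ≥ 1 all such primes are ≤ m).
rad : ℕ → ℕ
rad m = product (filter (λ p → prime? p ×-dec p ∣? m) (upTo (suc m)))

⟦_⟧ : ℕ → ℚ
⟦ n ⟧ = + n / 1

_^ℚ_ : ℚ → ℕ → ℚ
q ^ℚ zero = ℚ.1ℚ
q ^ℚ suc e = q ℚ.* (q ^ℚ e)

-- The abc-conjecture, with ε = u / v (u, v ≥ 1) and the constant C a natural number;
-- max ≤ C κ^(1+u/v) is written with the exponent cleared: max^v ≤ C * κ^(v+u).
ABC : Set
ABC = ∀ (u v : ℕ) → 1 ℕ.≤ u → 1 ℕ.≤ v →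
      ∃ λ (C : ℕ) → ∀ (a b c : ℤ) →
        ¬ (a ≡ ℤ.0ℤ) → ¬ (b ≡ ℤ.0ℤ) → ¬ (c ≡ ℤ.0ℤ) →
        a ℤ.+ b ≡ c → Coprime ∣ a ∣ ∣ b ∣ →
        ((∣ a ∣ ⊔ ∣ b ∣ ⊔ ∣ c ∣) ℕ.^ v) ℕ.≤ C ℕ.* (rad ∣ a ℤ.* b ℤ.* c ∣ ℕ.^ (v ℕ.+ u))

KFullIn : ℕ → ℚ → ℚ → List ℕ → Set
KFullIn k x y ns = Unique ns × All (λ n → x ℚ.< ⟦ n ⟧ × ⟦ n ⟧ ℚ.≤ x ℚ.+ y × KFull k n) ns

-- Write two k-full numbers m < n as m = a g and n = (a + b) g with a, b coprime.
-- The abc-conjecture with ε = 1/V, V = k v, for the coprime triple a + b = c gives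
-- c^V ≪ rad(a b c)^(V + 1), and rad(a b c) ≤ rad m · rad n · b with rad(m)^k ≤ m and
-- rad(n)^k ≤ n; raising to the k-th power and scaling by g yields
-- n^(V k) ≪ (n² (n − m)^k)^(V + 1).
-- For k ≥ 3 a positive power n^f survives division by n^(2 (V + 1)), so k-full
-- numbers n > m ≥ Y are far apart: Y^f ≪ (n − m)^(k (V + 1)). On the other hand
-- N + 1 of them in an interval of length Y have a consecutive gap of at most Y / N,
-- whence N^(k (V + 1)) ≪ Y^(2 (V + 1) + k), and a V-th root gives N^(k v) ≪ y^(2 v + u).
module Submission where

open import Defs
open import Data.Integer as ℤ using (+_; ∣_∣)
import Data.Integer.Properties as ℤP
open import Data.List using (List; []; _∷_; filter; upTo; length)
open import Data.List.Membership.Propositional using (_∈_)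
open import Data.List.Membership.Propositional.Properties using (∈-filter⁺; ∈-filter⁻; ∈-upTo⁺)
open import Data.List.Relation.Unary.All as All using (All; []; _∷_)
open import Data.List.Relation.Unary.Any using (here; there)
open import Data.List.Relation.Unary.Linked using (Linked; []; [-]; _∷_)
open import Data.List.Relation.Unary.Unique.Propositional using (Unique; []; _∷_)
open import Data.List.Relation.Unary.Unique.Propositional.Properties using (filter⁺; upTo⁺)
open import Data.List.Relation.Binary.Permutation.Propositional using (_↭_; ↭-sym; ↭⇒↭ₛ)
open import Data.List.Relation.Binary.Permutation.Propositional.Properties using (All-resp-↭; ↭-length)
open import Data.Nat as ℕ
  using (ℕ; zero; suc; _+_; _*_; _^_; _∸_; _⊔_; _≤_; _<_; z≤n; s≤s; NonZero;
         ≢-nonZero; ≢-nonZero⁻¹; >-nonZero; >-nonZero⁻¹)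
open import Data.Nat.Coprimality as Coprimality using (Coprime; coprime-divisor; coprime-/gcd)
open import Data.Nat.Divisibility
open import Data.Nat.DivMod using (_/_; m/n*n≡m)
open import Data.Nat.GCD using (gcd; gcd[m,n]∣m; gcd[m,n]∣n; gcd[m,n]≢0)
open import Data.Nat.ListAction using (product)
open import Data.Nat.ListAction.Properties using (∈⇒∣product)
open import Data.Nat.Primality
open import Data.Nat.Properties
open import Data.Nat.Tactic.RingSolver using (solve-∀)
open import Algebra.Properties.CommutativeSemigroup *-commutativeSemigroup using (x∙yz≈y∙xz)
open import Data.List.Sort ≤-decTotalOrder using (sort; sort-↭; sort-↗)
open import Data.Product using (∃; ∃₂; _×_; _,_; proj₁; proj₂)
open import Data.Rational as ℚ using (ℚ; mkℚ)
import Data.Rational.Properties as ℚP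
open import Data.Sum using (inj₁; inj₂)
open import Function using (_∘_)
open import Relation.Nullary using (¬_; contradiction; yes; no)
open import Relation.Nullary.Decidable using (_×-dec_)
open import Relation.Binary.PropositionalEquality
open import Data.List.Relation.Binary.Permutation.Setoid.Properties (setoid ℕ) using (Unique-resp-↭)

⟦⟧≡mkℚ : ∀ n → ⟦ n ⟧ ≡ mkℚ (+ n) 0 (Coprimality.sym (Coprimality.1-coprimeTo n))
⟦⟧≡mkℚ n = ℚP.normalize-coprime _

⟦⟧-mono-≤ : ∀ {m n} → m ≤ n → ⟦ m ⟧ ℚ.≤ ⟦ n ⟧
⟦⟧-mono-≤ {m} {n} m≤n rewrite ⟦⟧≡mkℚ m | ⟦⟧≡mkℚ n =
  ℚ.*≤* (subst₂ ℤ._≤_ (sym (ℤP.*-identityʳ (+ m))) (sym (ℤP.*-identityʳ (+ n))) (ℤ.+≤+ m≤n))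

⟦⟧-cancel-< : ∀ {m n} → ⟦ m ⟧ ℚ.< ⟦ n ⟧ → m < n
⟦⟧-cancel-< {m} {n} m<n rewrite ⟦⟧≡mkℚ m | ⟦⟧≡mkℚ n with m<n
... | ℚ.*<* m<n = ℤP.drop‿+<+ (subst₂ ℤ._<_ (ℤP.*-identityʳ (+ m)) (ℤP.*-identityʳ (+ n)) m<n)

⟦⟧-homo-* : ∀ m n → ⟦ m ⟧ ℚ.* ⟦ n ⟧ ≡ ⟦ m * n ⟧
⟦⟧-homo-* m n rewrite ⟦⟧≡mkℚ m | ⟦⟧≡mkℚ n = cong (ℚ._/ 1) (sym (ℤP.pos-* m n))

⟦⟧-homo-+ : ∀ m n → ⟦ m ⟧ ℚ.+ ⟦ n ⟧ ≡ ⟦ m + n ⟧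
⟦⟧-homo-+ m n rewrite ⟦⟧≡mkℚ m | ⟦⟧≡mkℚ n =
  cong (ℚ._/ 1) (trans (cong₂ ℤ._+_ (ℤP.*-identityʳ (+ m)) (ℤP.*-identityʳ (+ n))) (sym (ℤP.pos-+ m n)))

⟦⟧-homo-^ : ∀ m e → ⟦ m ⟧ ^ℚ e ≡ ⟦ m ^ e ⟧
⟦⟧-homo-^ m zero    = refl
⟦⟧-homo-^ m (suc e) = trans (cong (⟦ m ⟧ ℚ.*_) (⟦⟧-homo-^ m e)) (⟦⟧-homo-* m (m ^ e))

^ℚ-nonNeg : ∀ {p} → ℚ.0ℚ ℚ.≤ p → ∀ e → ℚ.0ℚ ℚ.≤ p ^ℚ e
^ℚ-nonNeg p≥0 zero    = ⟦⟧-mono-≤ {0} {1} z≤n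
^ℚ-nonNeg {p} p≥0 (suc e) = subst (ℚ._≤ p ℚ.* p ^ℚ e) (ℚP.*-zeroˡ (p ^ℚ e))
  (ℚP.*-monoʳ-≤-nonNeg (p ^ℚ e) {{ℚ.nonNegative (^ℚ-nonNeg p≥0 e)}} p≥0)

^ℚ-monoˡ-≤ : ∀ {p q} → ℚ.0ℚ ℚ.≤ p → p ℚ.≤ q → ∀ e → p ^ℚ e ℚ.≤ q ^ℚ e
^ℚ-monoˡ-≤ p≥0 p≤q zero    = ℚP.≤-refl
^ℚ-monoˡ-≤ {p} {q} p≥0 p≤q (suc e) = ℚP.≤-trans
  (ℚP.*-monoʳ-≤-nonNeg (p ^ℚ e) {{ℚ.nonNegative (^ℚ-nonNeg p≥0 e)}} p≤q)
  (ℚP.*-monoˡ-≤-nonNeg q {{ℚ.nonNegative (ℚP.≤-trans p≥0 p≤q)}} (^ℚ-monoˡ-≤ p≥0 p≤q e))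

⟦⟧-^-bound : ∀ {c m n y} a b → ⟦ m ⟧ ℚ.≤ y → n ^ a ≤ c * m ^ b → ⟦ n ⟧ ^ℚ a ℚ.≤ ⟦ c ⟧ ℚ.* y ^ℚ b
⟦⟧-^-bound {c} {m} {n} {y} a b m≤y nᵃ≤cmᵇ = begin
  ⟦ n ⟧ ^ℚ a              ≡⟨ ⟦⟧-homo-^ n a ⟩
  ⟦ n ^ a ⟧               ≤⟨ ⟦⟧-mono-≤ nᵃ≤cmᵇ ⟩
  ⟦ c * m ^ b ⟧           ≡⟨ sym (⟦⟧-homo-* c (m ^ b)) ⟩
  ⟦ c ⟧ ℚ.* ⟦ m ^ b ⟧     ≡⟨ cong (⟦ c ⟧ ℚ.*_) (sym (⟦⟧-homo-^ m b)) ⟩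
  ⟦ c ⟧ ℚ.* ⟦ m ⟧ ^ℚ b    ≤⟨ ℚP.*-monoˡ-≤-nonNeg ⟦ c ⟧ {{ℚ.nonNegative (⟦⟧-mono-≤ {0} {c} z≤n)}}
                               (^ℚ-monoˡ-≤ (⟦⟧-mono-≤ {0} {m} z≤n) m≤y b) ⟩
  ⟦ c ⟧ ℚ.* y ^ℚ b        ∎
  where open ℚP.≤-Reasoning

⟦⊔⟧≤ : ∀ {m n q} → ⟦ m ⟧ ℚ.≤ q → ⟦ n ⟧ ℚ.≤ q → ⟦ m ⊔ n ⟧ ℚ.≤ q
⟦⊔⟧≤ {m} {n} m≤q n≤q with ⊔-sel m n
... | inj₁ m⊔n≡m = subst (λ t → ⟦ t ⟧ ℚ.≤ _) (sym m⊔n≡m) m≤q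
... | inj₂ m⊔n≡n = subst (λ t → ⟦ t ⟧ ℚ.≤ _) (sym m⊔n≡n) n≤q

⟦n∸m⟧≤ : ∀ {x y m n} → x ℚ.< ⟦ m ⟧ → ⟦ n ⟧ ℚ.≤ x ℚ.+ y → m ≤ n → ⟦ n ∸ m ⟧ ℚ.≤ y
⟦n∸m⟧≤ {x} {y} {m} {n} x<m n≤x+y m≤n with ⟦ n ∸ m ⟧ ℚ.≤? y
... | yes n∸m≤y = n∸m≤y
... | no  n∸m≰y = contradiction x+y<x+y (ℚP.<-irrefl refl)
  where
  open ℚP.≤-Reasoning
  x+y<x+y : x ℚ.+ y ℚ.< x ℚ.+ y
  x+y<x+y = begin-strict
    x ℚ.+ y               <⟨ ℚP.+-monoˡ-< y x<m ⟩
    ⟦ m ⟧ ℚ.+ y           ≤⟨ ℚP.+-monoʳ-≤ ⟦ m ⟧ (ℚP.<⇒≤ (ℚP.≰⇒> n∸m≰y)) ⟩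
    ⟦ m ⟧ ℚ.+ ⟦ n ∸ m ⟧   ≡⟨ ⟦⟧-homo-+ m (n ∸ m) ⟩
    ⟦ m + (n ∸ m) ⟧       ≡⟨ cong ⟦_⟧ (m+[n∸m]≡n m≤n) ⟩
    ⟦ n ⟧                 ≤⟨ n≤x+y ⟩
    x ℚ.+ y               ∎

^-distribʳ-* : ∀ m n o → (m * n) ^ o ≡ m ^ o * n ^ o
^-distribʳ-* m n zero    = refl
^-distribʳ-* m n (suc o) = trans (cong (m * n *_) (^-distribʳ-* m n o))
                                 ([m*n]*[o*p]≡[m*o]*[n*p] m n (m ^ o) (n ^ o))

^-^-comm : ∀ m n o → (m ^ n) ^ o ≡ (m ^ o) ^ n
^-^-comm m n o = trans (^-*-assoc m n o) (trans (cong (m ^_) (*-comm n o)) (sym (^-*-assoc m o n)))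

m≤m^n : ∀ m n .{{_ : NonZero n}} → m ≤ m ^ n
m≤m^n zero    n = z≤n
m≤m^n (suc m) n = subst (_≤ suc m ^ n) (^-identityʳ (suc m)) (^-monoʳ-≤ (suc m) (>-nonZero⁻¹ n))

m^e≤l*n^e⇒m≤l*n : ∀ {m n l} e .{{_ : NonZero e}} → m ^ e ≤ l * n ^ e → m ≤ l * n
m^e≤l*n^e⇒m≤l*n {m} {n} {l} e mᵉ≤lnᵉ with m ℕ.≤? l * n
... | yes m≤ln = m≤ln
... | no  m≰ln = contradiction mᵉ≤lnᵉ (<⇒≱ (begin-strict
  l * n ^ e       ≤⟨ *-monoˡ-≤ (n ^ e) (m≤m^n l e) ⟩
  l ^ e * n ^ e   ≡⟨ sym (^-distribʳ-* l n e) ⟩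
  (l * n) ^ e     <⟨ ^-monoˡ-< e (≰⇒> m≰ln) ⟩
  m ^ e           ∎))
  where open ≤-Reasoning

[1+m]^n≤2^n*m^n : ∀ {m} n → 1 ≤ m → suc m ^ n ≤ 2 ^ n * m ^ n
[1+m]^n≤2^n*m^n {m} n m≥1 = begin
  suc m ^ n     ≤⟨ ^-monoˡ-≤ n 1+m≤2*m ⟩
  (2 * m) ^ n   ≡⟨ ^-distribʳ-* 2 m n ⟩
  2 ^ n * m ^ n ∎
  where
  open ≤-Reasoning
  1+m≤2*m : suc m ≤ 2 * m
  1+m≤2*m = subst (_≤ 2 * m) (+-comm m 1) (+-monoʳ-≤ m (subst (1 ≤_) (sym (+-identityʳ m)) m≥1))

spacing-bound : ∀ {K Y b D m} f s → 1 ≤ Y → Y ≤ b → b ^ f ≤ K * D ^ (f + s) → m * D ≤ Y →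
  m ^ (f + s) ≤ K * Y ^ s
spacing-bound {K} {Y} {b} {D} {m} f s Y≥1 Y≤b bᶠ≤KDᵉ mD≤Y =
  *-cancelˡ-≤ (Y ^ f) {{m^n≢0 Y f {{>-nonZero Y≥1}}}} (begin
    Y ^ f * m ^ e        ≤⟨ *-monoˡ-≤ (m ^ e) (≤-trans (^-monoˡ-≤ f Y≤b) bᶠ≤KDᵉ) ⟩
    K * D ^ e * m ^ e    ≡⟨ *-assoc K (D ^ e) (m ^ e) ⟩
    K * (D ^ e * m ^ e)  ≡⟨ cong (K *_) (trans (*-comm (D ^ e) (m ^ e)) (sym (^-distribʳ-* m D e))) ⟩
    K * (m * D) ^ e      ≤⟨ *-monoʳ-≤ K (^-monoˡ-≤ e mD≤Y) ⟩
    K * Y ^ (f + s)      ≡⟨ cong (K *_) (^-distribˡ-+-* Y f s) ⟩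
    K * (Y ^ f * Y ^ s)  ≡⟨ x∙yz≈y∙xz K (Y ^ f) (Y ^ s) ⟩
    Y ^ f * (K * Y ^ s)  ∎)
  where
  open ≤-Reasoning
  e : ℕ
  e = f + s

-- Coprimality and radicals

coprime-*ʳ : ∀ {a b c} → Coprime a b → Coprime a c → Coprime a (b * c)
coprime-*ʳ a⊥b a⊥c (d∣a , d∣bc) =
  a⊥c (d∣a , coprime-divisor (λ (e∣d , e∣b) → a⊥b (∣-trans e∣d d∣a , e∣b)) d∣bc)

coprime-^ʳ : ∀ {a b} → Coprime a b → ∀ n → Coprime a (b ^ n)
coprime-^ʳ {a} a⊥b zero    = Coprimality.sym (Coprimality.1-coprimeTo a)
coprime-^ʳ     a⊥b (suc n) = coprime-*ʳ a⊥b (coprime-^ʳ a⊥b n)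

coprime-^ : ∀ {a b} → Coprime a b → ∀ n → Coprime (a ^ n) (b ^ n)
coprime-^ a⊥b n = Coprimality.sym (coprime-^ʳ (Coprimality.sym (coprime-^ʳ a⊥b n)) n)

coprime-product : ∀ {a bs} → All (Coprime a) bs → Coprime a (product bs)
coprime-product {a} []             = Coprimality.sym (Coprimality.1-coprimeTo a)
coprime-product     (a⊥b ∷ a⊥bs) = coprime-*ʳ a⊥b (coprime-product a⊥bs)

coprime⇒*∣ : ∀ {a b n} → Coprime a b → a ∣ n → b ∣ n → a * b ∣ n
coprime⇒*∣ {a} {b} a⊥b a∣n (divides q refl) =
  *-monoˡ-∣ b (coprime-divisor a⊥b (subst (a ∣_) (*-comm q b) a∣n))

prime∤⇒coprime : ∀ {p n} → Prime p → ¬ p ∣ n → Coprime p n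
prime∤⇒coprime p-prime p∤n (d∣p , d∣n) with prime⇒irreducible p-prime d∣p
... | inj₁ d≡1 = d≡1
... | inj₂ refl = contradiction d∣n p∤n

distinct-primes-coprime : ∀ {p q} → Prime p → Prime q → p ≢ q → Coprime p q
distinct-primes-coprime {p} {q} p-prime q-prime p≢q = prime∤⇒coprime p-prime p∤q
  where
  p∤q : ¬ p ∣ q
  p∤q p∣q with prime⇒irreducible q-prime p∣q
  ... | inj₁ refl = ¬prime[1] p-prime
  ... | inj₂ p≡q  = p≢q p≡q

product-primes^∣ : ∀ k {n ps} → Unique ps → All Prime ps → All (λ p → p ^ k ∣ n) ps → product ps ^ k ∣ n
product-primes^∣ k {n} {[]} _ _ _ = subst (_∣ n) (sym (^-zeroˡ k)) (1∣ n)
product-primes^∣ k {n} {p ∷ ps} (p∉ps ∷ distinct) (p-prime ∷ primes) (pᵏ∣n ∷ ps-divide) =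
  subst (_∣ n) (sym (^-distribʳ-* p (product ps) k))
    (coprime⇒*∣ (coprime-^ p⊥ps k) pᵏ∣n (product-primes^∣ k distinct primes ps-divide))
  where
  p⊥ps : Coprime p (product ps)
  p⊥ps = coprime-product (All.zipWith {R = Coprime p} p⊥q (primes , p∉ps))
    where
    p⊥q : ∀ {q} → Prime q × p ≢ q → Coprime p q
    p⊥q (q-prime , p≢q) = distinct-primes-coprime p-prime q-prime p≢q

radPrimes : ℕ → List ℕ
radPrimes m = filter (λ p → prime? p ×-dec p ∣? m) (upTo (suc m))

∈-radPrimes⁻ : ∀ {m p} → p ∈ radPrimes m → Prime p × p ∣ m
∈-radPrimes⁻ {m} = proj₂ ∘ ∈-filter⁻ (λ p → prime? p ×-dec p ∣? m) {xs = upTo (suc m)}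

∈-radPrimes⁺ : ∀ {m p} → 0 < m → Prime p → p ∣ m → p ∈ radPrimes m
∈-radPrimes⁺ {m} m>0 p-prime p∣m =
  ∈-filter⁺ (λ p → prime? p ×-dec p ∣? m) (∈-upTo⁺ (s≤s (∣⇒≤ {{>-nonZero m>0}} p∣m))) (p-prime , p∣m)

radPrimes-unique : ∀ m → Unique (radPrimes m)
radPrimes-unique m = filter⁺ (λ p → prime? p ×-dec p ∣? m) (upTo⁺ (suc m))

radPrimes-primes : ∀ m → All Prime (radPrimes m)
radPrimes-primes m = All.tabulate λ p∈ → proj₁ (∈-radPrimes⁻ {m} p∈)

rad≥1 : ∀ m → 1 ≤ rad m
rad≥1 m = productOfPrimes≥1 (radPrimes-primes m)

prime∣⇒∣rad : ∀ {m p} → 0 < m → Prime p → p ∣ m → p ∣ rad m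
prime∣⇒∣rad m>0 p-prime p∣m = ∈⇒∣product (∈-radPrimes⁺ m>0 p-prime p∣m)

rad∣ : ∀ {m n} → (∀ {p} → Prime p → p ∣ m → p ∣ n) → rad m ∣ n
rad∣ {m} {n} primes-divide = subst (_∣ n) (^-identityʳ (rad m))
  (product-primes^∣ 1 (radPrimes-unique m) (radPrimes-primes m) (All.tabulate λ p∈ →
    let (p-prime , p∣m) = ∈-radPrimes⁻ p∈ in subst (_∣ n) (sym (^-identityʳ _)) (primes-divide p-prime p∣m)))

kfull⇒rad^k≤ : ∀ {k n} → KFull k n → 0 < n → rad n ^ k ≤ n
kfull⇒rad^k≤ {k} {n} n-kfull n>0 = ∣⇒≤ {{>-nonZero n>0}}
  (product-primes^∣ k (radPrimes-unique n) (radPrimes-primes n) (All.tabulate λ p∈ →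
    let (p-prime , p∣n) = ∈-radPrimes⁻ p∈ in n-kfull _ p-prime p∣n))

rad[a*b*c]≤ : ∀ {a b c m n} → a ∣ m → c ∣ n → 0 < m → 0 < n → 0 < b → rad (a * b * c) ≤ rad m * rad n * b
rad[a*b*c]≤ {a} {b} {c} {m} {n} a∣m c∣n m>0 n>0 b>0 =
  ∣⇒≤ {{>-nonZero (*-mono-≤ (*-mono-≤ (rad≥1 m) (rad≥1 n)) b>0)}} (rad∣ prime-divides)
  where
  prime-divides : ∀ {p} → Prime p → p ∣ a * b * c → p ∣ rad m * rad n * b
  prime-divides p-prime p∣abc with euclidsLemma (a * b) c p-prime p∣abc
  ... | inj₂ p∣c = ∣m⇒∣m*n b (∣n⇒∣m*n (rad m) (prime∣⇒∣rad n>0 p-prime (∣-trans p∣c c∣n)))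
  ... | inj₁ p∣ab with euclidsLemma a b p-prime p∣ab
  ...   | inj₁ p∣a = ∣m⇒∣m*n b (∣m⇒∣m*n (rad n) (prime∣⇒∣rad m>0 p-prime (∣-trans p∣a a∣m)))
  ...   | inj₂ p∣b = ∣n⇒∣m*n (rad m * rad n) p∣b

-- The abc bound for pairs of k-full numbers

ABCBound : ℕ → ℕ → Set
ABCBound V C = ∀ a b → 0 < a → 0 < b → Coprime a b → (a + b) ^ V ≤ C * rad (a * b * (a + b)) ^ (V + 1)

abc⇒ABCBound : ABC → ∀ V → 1 ≤ V → ∃ λ C → ABCBound V (suc C)
abc⇒ABCBound abc V V≥1 with abc 1 V ≤-refl V≥1
... | C , abc-C = C , λ a b a>0 b>0 a⊥b → begin
  (a + b) ^ V                                       ≤⟨ ^-monoˡ-≤ V (m≤n⊔m (a ⊔ b) (a + b)) ⟩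
  (a ⊔ b ⊔ (a + b)) ^ V                             ≤⟨ abc-C (+ a) (+ b) (+ (a + b))
                                                        (+≢0 a>0) (+≢0 b>0) (+≢0 (≤-trans a>0 (m≤m+n a b)))
                                                        refl a⊥b ⟩
  C * rad ∣ + a ℤ.* + b ℤ.* + (a + b) ∣ ^ (V + 1)   ≡⟨ cong (λ r → C * rad r ^ (V + 1))
                                                            (∣abc∣≡abc {a} {b} {a + b}) ⟩
  C * rad (a * b * (a + b)) ^ (V + 1)               ≤⟨ *-monoˡ-≤ _ (n≤1+n C) ⟩
  suc C * rad (a * b * (a + b)) ^ (V + 1)           ∎
  where
  open ≤-Reasoning
  +≢0 : ∀ {n} → 0 < n → ¬ (+ n ≡ ℤ.0ℤ)
  +≢0 (s≤s _) ()
  ∣abc∣≡abc : ∀ {a b c} → ∣ + a ℤ.* + b ℤ.* + c ∣ ≡ a * b * c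
  ∣abc∣≡abc {a} {b} {c} = trans (ℤP.abs-* (+ a ℤ.* + b) (+ c)) (cong (_* c) (ℤP.abs-* (+ a) (+ b)))

coprime-decomposition : ∀ {m n} → 0 < m → m < n →
  ∃₂ λ a b → ∃ λ g → 0 < a × 0 < b × 0 < g × Coprime a b × m ≡ a * g × n ≡ (a + b) * g
coprime-decomposition {m} {n} m>0 m<n =
  a , c ∸ a , g , a>0 , m<n⇒0<n∸m a<c , >-nonZero⁻¹ g , a⊥b , sym a*g≡m ,
  sym (trans (cong (_* g) (m+[n∸m]≡n (<⇒≤ a<c))) c*g≡n)
  where
  g : ℕ
  g = gcd m n
  instance
    g≢0 : NonZero g
    g≢0 = ≢-nonZero (gcd[m,n]≢0 m n (inj₁ (≢-nonZero⁻¹ m {{>-nonZero m>0}})))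
  a c : ℕ
  a = m / g
  c = n / g
  a*g≡m : a * g ≡ m
  a*g≡m = m/n*n≡m (gcd[m,n]∣m m n)
  c*g≡n : c * g ≡ n
  c*g≡n = m/n*n≡m (gcd[m,n]∣n m n)
  a<c : a < c
  a<c = *-cancelʳ-< g a c (subst₂ _<_ (sym a*g≡m) (sym c*g≡n) m<n)
  a>0 : 0 < a
  a>0 = >-nonZero⁻¹ a {{m*n≢0⇒m≢0 a {{subst NonZero (sym a*g≡m) (>-nonZero m>0)}}}}
  a⊥b : Coprime a (c ∸ a)
  a⊥b (d∣a , d∣c∸a) = coprime-/gcd m n (d∣a , ∣m∸n∣n⇒∣m _ (<⇒≤ a<c) d∣c∸a d∣a)

coprime-pair-bound : ∀ {V C k m n a b} → ABCBound V C → 0 < a → 0 < b → Coprime a b →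
  a ∣ m → a + b ∣ n → 0 < m → 0 < n → KFull k m → KFull k n →
  (a + b) ^ (V * k) ≤ C ^ k * (m * n * b ^ k) ^ (V + 1)
coprime-pair-bound {V} {C} {k} {m} {n} {a} {b} abc a>0 b>0 a⊥b a∣m a+b∣n m>0 n>0 m-kfull n-kfull = begin
  (a + b) ^ (V * k)            ≡⟨ sym (^-*-assoc (a + b) V k) ⟩
  ((a + b) ^ V) ^ k            ≤⟨ ^-monoˡ-≤ k (abc a b a>0 b>0 a⊥b) ⟩
  (C * ρ ^ W) ^ k              ≡⟨ ^-distribʳ-* C (ρ ^ W) k ⟩
  C ^ k * (ρ ^ W) ^ k          ≡⟨ cong (C ^ k *_) (^-^-comm ρ W k) ⟩
  C ^ k * (ρ ^ k) ^ W          ≤⟨ *-monoʳ-≤ (C ^ k) (^-monoˡ-≤ W ρᵏ≤mnbᵏ) ⟩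
  C ^ k * (m * n * b ^ k) ^ W  ∎
  where
  open ≤-Reasoning
  W ρ : ℕ
  W = V + 1
  ρ = rad (a * b * (a + b))
  ρᵏ≤mnbᵏ : ρ ^ k ≤ m * n * b ^ k
  ρᵏ≤mnbᵏ = begin
    ρ ^ k                          ≤⟨ ^-monoˡ-≤ k (rad[a*b*c]≤ a∣m a+b∣n m>0 n>0 b>0) ⟩
    (rad m * rad n * b) ^ k        ≡⟨ ^-distribʳ-* (rad m * rad n) b k ⟩
    (rad m * rad n) ^ k * b ^ k    ≡⟨ cong (_* b ^ k) (^-distribʳ-* (rad m) (rad n) k) ⟩
    rad m ^ k * rad n ^ k * b ^ k  ≤⟨ *-monoˡ-≤ (b ^ k) (*-mono-≤ (kfull⇒rad^k≤ {k} m-kfull m>0)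
                                                               (kfull⇒rad^k≤ {k} n-kfull n>0)) ⟩
    m * n * b ^ k                  ∎

kfull-pair-bound : ∀ {V C k m n} → ABCBound V C → 0 < m → m < n → KFull k m → KFull k n →
  n ^ (V * k) ≤ C ^ k * (n * n * (n ∸ m) ^ k) ^ (V + 1)
kfull-pair-bound {V} {C} {k} {m} {n} abc m>0 m<n m-kfull n-kfull with coprime-decomposition m>0 m<n
... | a , b , g , a>0 , b>0 , g>0 , a⊥b , m≡a*g , n≡[a+b]*g = begin
  n ^ (V * k)                                    ≡⟨ cong (_^ (V * k)) n≡[a+b]*g ⟩
  ((a + b) * g) ^ (V * k)                        ≡⟨ ^-distribʳ-* (a + b) g (V * k) ⟩
  (a + b) ^ (V * k) * g ^ (V * k)                ≤⟨ *-mono-≤ coprime-part gᵛᵏ≤gᵏʷ ⟩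
  C ^ k * (m * n * b ^ k) ^ W * (g ^ k) ^ W      ≡⟨ *-assoc (C ^ k) _ _ ⟩
  C ^ k * ((m * n * b ^ k) ^ W * (g ^ k) ^ W)    ≡⟨ cong (C ^ k *_) (sym (^-distribʳ-* _ (g ^ k) W)) ⟩
  C ^ k * (m * n * b ^ k * g ^ k) ^ W            ≡⟨ cong (λ t → C ^ k * t ^ W) regroup ⟩
  C ^ k * (m * n * (n ∸ m) ^ k) ^ W              ≤⟨ *-monoʳ-≤ (C ^ k) (^-monoˡ-≤ W
                                                      (*-monoˡ-≤ ((n ∸ m) ^ k) (*-monoˡ-≤ n (<⇒≤ m<n)))) ⟩
  C ^ k * (n * n * (n ∸ m) ^ k) ^ W              ∎
  where
  open ≤-Reasoning
  W : ℕ
  W = V + 1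
  coprime-part : (a + b) ^ (V * k) ≤ C ^ k * (m * n * b ^ k) ^ W
  coprime-part = coprime-pair-bound {V} {C} {k} abc a>0 b>0 a⊥b
    (divides g (trans m≡a*g (*-comm a g))) (divides g (trans n≡[a+b]*g (*-comm (a + b) g)))
    m>0 (<-trans m>0 m<n) m-kfull n-kfull
  gᵛᵏ≤gᵏʷ : g ^ (V * k) ≤ (g ^ k) ^ W
  gᵛᵏ≤gᵏʷ = begin
    g ^ (V * k)   ≡⟨ trans (sym (^-*-assoc g V k)) (^-^-comm g V k) ⟩
    (g ^ k) ^ V   ≤⟨ ^-monoʳ-≤ (g ^ k) {{m^n≢0 g k {{>-nonZero g>0}}}} (m≤m+n V 1) ⟩
    (g ^ k) ^ W   ∎
  n∸m≡b*g : n ∸ m ≡ b * g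
  n∸m≡b*g = trans (cong₂ _∸_ n≡[a+b]*g m≡a*g)
                  (trans (sym (*-distribʳ-∸ g (a + b) a)) (cong (_* g) (m+n∸m≡n a b)))
  regroup : m * n * b ^ k * g ^ k ≡ m * n * (n ∸ m) ^ k
  regroup = trans (*-assoc (m * n) (b ^ k) (g ^ k))
                  (cong (m * n *_) (trans (sym (^-distribʳ-* b g k)) (cong (_^ k) (sym n∸m≡b*g))))

-- Gaps in increasing lists

lastOf : ℕ → List ℕ → ℕ
lastOf z []       = z
lastOf _ (w ∷ ws) = lastOf w ws

lastOf∈ : ∀ z ws → lastOf z ws ∈ z ∷ ws
lastOf∈ z []       = here refl
lastOf∈ z (w ∷ ws) = there (lastOf∈ w ws)

head≤ : ∀ {z ws n} → Linked _<_ (z ∷ ws) → n ∈ z ∷ ws → z ≤ n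
head≤ _         (here refl) = ≤-refl
head≤ (z<w ∷ l) (there n∈)  = ≤-trans (<⇒≤ z<w) (head≤ l n∈)

∸-split : ∀ {x y z} → x ≤ y → y ≤ z → (y ∸ x) + (z ∸ y) ≡ z ∸ x
∸-split {x} {y} {z} x≤y y≤z = +-cancelˡ-≡ x _ _ (begin-equality
  x + ((y ∸ x) + (z ∸ y))   ≡⟨ sym (+-assoc x (y ∸ x) (z ∸ y)) ⟩
  x + (y ∸ x) + (z ∸ y)     ≡⟨ cong (_+ (z ∸ y)) (m+[n∸m]≡n x≤y) ⟩
  y + (z ∸ y)               ≡⟨ m+[n∸m]≡n y≤z ⟩
  z                         ≡⟨ sym (m+[n∸m]≡n (≤-trans x≤y y≤z)) ⟩
  x + (z ∸ x)               ∎)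
  where open ≤-Reasoning

-- Among the 1 + length ws consecutive gaps of z ∷ w ∷ ws the smallest one, times
-- their number, is at most their sum lastOf w ws ∸ z.
small-gap : ∀ z w ws → Linked _<_ (z ∷ w ∷ ws) →
  ∃₂ λ a b → a ∈ z ∷ w ∷ ws × b ∈ z ∷ w ∷ ws × a < b × suc (length ws) * (b ∸ a) ≤ lastOf w ws ∸ z
small-gap z w []       (z<w ∷ _) =
  z , w , here refl , there (here refl) , z<w , ≤-reflexive (*-identityˡ (w ∸ z))
small-gap z w (x ∷ ws) (z<w ∷ l) with small-gap w x ws l
... | a , b , a∈ , b∈ , a<b , rest with (w ∸ z) ℕ.≤? (b ∸ a)
...   | yes first≤ = z , w , here refl , there (here refl) , z<w , (begin
  (w ∸ z) + suc (length ws) * (w ∸ z)  ≤⟨ +-monoʳ-≤ (w ∸ z) (*-monoʳ-≤ (suc (length ws)) first≤) ⟩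
  (w ∸ z) + suc (length ws) * (b ∸ a)  ≤⟨ +-monoʳ-≤ (w ∸ z) rest ⟩
  (w ∸ z) + (lastOf x ws ∸ w)          ≡⟨ ∸-split (<⇒≤ z<w) (head≤ l (lastOf∈ w (x ∷ ws))) ⟩
  lastOf x ws ∸ z                      ∎)
  where open ≤-Reasoning
...   | no first≰ = a , b , there a∈ , there b∈ , a<b , (begin
  (b ∸ a) + suc (length ws) * (b ∸ a)  ≤⟨ +-monoˡ-≤ _ (<⇒≤ (≰⇒> first≰)) ⟩
  (w ∸ z) + suc (length ws) * (b ∸ a)  ≤⟨ +-monoʳ-≤ (w ∸ z) rest ⟩
  (w ∸ z) + (lastOf x ws ∸ w)          ≡⟨ ∸-split (<⇒≤ z<w) (head≤ l (lastOf∈ w (x ∷ ws))) ⟩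
  lastOf x ws ∸ z                      ∎)
  where open ≤-Reasoning

sorted∧unique⇒increasing : ∀ {xs} → Linked _≤_ xs → Unique xs → Linked _<_ xs
sorted∧unique⇒increasing []        _                 = []
sorted∧unique⇒increasing [-]       _                 = [-]
sorted∧unique⇒increasing (x≤y ∷ l) ((x≢y ∷ _) ∷ u) = ≤∧≢⇒< x≤y x≢y ∷ sorted∧unique⇒increasing l u

increasing-permutation : ∀ ns → Unique ns → ∃ λ zs → zs ↭ ns × Linked _<_ zs
increasing-permutation ns unique = sort ns , sort-↭ ns ,
  sorted∧unique⇒increasing (sort-↗ ns) (Unique-resp-↭ (↭⇒↭ₛ (↭-sym (sort-↭ ns))) unique)

-- Counting k-full numbers in short intervals

[V+1]+[V+1]≤V*k : ∀ {V k} → 2 ≤ V → 3 ≤ k → (V + 1) + (V + 1) ≤ V * k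
[V+1]+[V+1]≤V*k {suc (suc V′)} {suc (suc (suc k′))} (s≤s (s≤s _)) (s≤s (s≤s (s≤s _))) =
  ≤-trans (m≤m+n _ _) (≤-reflexive (sym (expand V′ k′)))
  where
  expand : ∀ V′ k′ → (2 + V′) * (3 + k′) ≡ ((2 + V′) + 1) + ((2 + V′) + 1) + (V′ + (2 + V′) * k′)
  expand = solve-∀

exponent-inequality : ∀ k v u → 1 ≤ u →
  ((k * v + 1) + (k * v + 1) + k) * (k * v) ≤ (2 * v + u) * (k * (k * v + 1))
exponent-inequality k v (suc u′) _ = ≤-trans (m≤m+n _ _) (≤-reflexive (sym (expand k v u′)))
  where
  expand : ∀ k v u′ → (2 * v + (1 + u′)) * (k * (k * v + 1))
                    ≡ ((k * v + 1) + (k * v + 1) + k) * (k * v) + (k + u′ * (k * (k * v + 1)))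
  expand = solve-∀

module Counting (k v u C : ℕ) (k≥3 : 3 ≤ k) (u≥1 : 1 ≤ u) (v≥1 : 1 ≤ v)
                (abc : ABCBound (k * v) (suc C)) where

  V W K E CF : ℕ
  V = k * v
  W = V + 1
  K = suc C ^ k
  E = 2 * v + u
  CF = 2 ^ V * K ^ V

  f s : ℕ
  f = V * k ∸ (W + W)
  s = W + W + k

  -- The only use of k ≥ 3: for k = 2 the factor n² lost in the pair bound is not
  -- compensated by n^(V k).
  V*k≡W+W+f : V * k ≡ W + W + f
  V*k≡W+W+f = sym (m+[n∸m]≡n ([V+1]+[V+1]≤V*k V≥2 k≥3))
    where
    V≥2 : 2 ≤ V
    V≥2 = *-mono-≤ (≤-trans (s≤s (s≤s z≤n)) k≥3) v≥1

  k*W≡f+s : k * W ≡ f + s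
  k*W≡f+s = begin
    k * (V + 1)          ≡⟨ distrib k V ⟩
    V * k + k            ≡⟨ cong (_+ k) V*k≡W+W+f ⟩
    W + W + f + k        ≡⟨ reorder (W + W) f k ⟩
    f + (W + W + k)      ∎
    where
    open ≡-Reasoning
    distrib : ∀ k V → k * (V + 1) ≡ V * k + k
    distrib = solve-∀
    reorder : ∀ x f k → x + f + k ≡ f + (x + k)
    reorder = solve-∀

  f+s>0 : 0 < f + s
  f+s>0 = ≤-trans (m≤n+m 1 V) (≤-trans (m≤m+n W W) (≤-trans (m≤m+n (W + W) k) (m≤n+m s f)))

  1^V≤CF*Y^E : ∀ {Y} → 1 ≤ Y → 1 ^ V ≤ CF * Y ^ E
  1^V≤CF*Y^E {Y} Y≥1 = subst (_≤ CF * Y ^ E) (sym (^-zeroˡ V))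
    (*-mono-≤ (*-mono-≤ (m^n>0 2 V) (m^n>0 K {{m^n≢0 (suc C) k}} V)) (m^n>0 Y {{>-nonZero Y≥1}} E))

  kfull-gap-bound : ∀ {a b} → 0 < a → a < b → KFull k a → KFull k b → b ^ f ≤ K * (b ∸ a) ^ (f + s)
  kfull-gap-bound {a} {b} a>0 a<b a-kfull b-kfull =
    *-cancelˡ-≤ (b ^ (W + W)) {{m^n≢0 b (W + W) {{>-nonZero (<-trans a>0 a<b)}}}} (begin
      b ^ (W + W) * b ^ f                     ≡⟨ sym (^-distribˡ-+-* b (W + W) f) ⟩
      b ^ (W + W + f)                         ≡⟨ cong (b ^_) (sym V*k≡W+W+f) ⟩
      b ^ (V * k)                             ≤⟨ kfull-pair-bound {V} {suc C} {k} abc a>0 a<b a-kfull b-kfull ⟩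
      K * (b * b * (b ∸ a) ^ k) ^ W           ≡⟨ cong (K *_) (^-distribʳ-* (b * b) ((b ∸ a) ^ k) W) ⟩
      K * ((b * b) ^ W * ((b ∸ a) ^ k) ^ W)   ≡⟨ cong₂ (λ p q → K * (p * q)) b²ᵂ≡bᵂ⁺ᵂ
                                                         (^-*-assoc (b ∸ a) k W) ⟩
      K * (b ^ (W + W) * (b ∸ a) ^ (k * W))   ≡⟨ x∙yz≈y∙xz K (b ^ (W + W)) _ ⟩
      b ^ (W + W) * (K * (b ∸ a) ^ (k * W))   ≡⟨ cong (λ t → b ^ (W + W) * (K * (b ∸ a) ^ t)) k*W≡f+s ⟩
      b ^ (W + W) * (K * (b ∸ a) ^ (f + s))   ∎)
    where
    open ≤-Reasoning
    b²ᵂ≡bᵂ⁺ᵂ : (b * b) ^ W ≡ b ^ (W + W)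
    b²ᵂ≡bᵂ⁺ᵂ = trans (^-distribʳ-* b b W) (sym (^-distribˡ-+-* b W W))

  root-bound : ∀ {m Y} → 1 ≤ Y → m ^ (f + s) ≤ K * Y ^ s → m ^ V ≤ K ^ V * Y ^ E
  root-bound {m} {Y} Y≥1 mᵉ≤KYˢ =
    m^e≤l*n^e⇒m≤l*n {m ^ V} {Y ^ E} {K ^ V} (f + s) {{>-nonZero f+s>0}} (begin
    (m ^ V) ^ (f + s)          ≡⟨ ^-^-comm m V (f + s) ⟩
    (m ^ (f + s)) ^ V          ≤⟨ ^-monoˡ-≤ V mᵉ≤KYˢ ⟩
    (K * Y ^ s) ^ V            ≡⟨ ^-distribʳ-* K (Y ^ s) V ⟩
    K ^ V * (Y ^ s) ^ V        ≡⟨ cong (K ^ V *_) (^-*-assoc Y s V) ⟩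
    K ^ V * Y ^ (s * V)        ≤⟨ *-monoʳ-≤ (K ^ V) (^-monoʳ-≤ Y {{>-nonZero Y≥1}} sV≤E[f+s]) ⟩
    K ^ V * Y ^ (E * (f + s))  ≡⟨ cong (K ^ V *_) (sym (^-*-assoc Y E (f + s))) ⟩
    K ^ V * (Y ^ E) ^ (f + s)  ∎)
    where
    open ≤-Reasoning
    sV≤E[f+s] : s * V ≤ E * (f + s)
    sV≤E[f+s] = subst (λ t → s * V ≤ E * t) k*W≡f+s (exponent-inequality k v u u≥1)

  count-increasing : ∀ Y → 1 ≤ Y → ∀ z ws → Linked _<_ (z ∷ ws) → All (KFull k) (z ∷ ws) →
    Y ≤ z → lastOf z ws ∸ z ≤ Y → length (z ∷ ws) ^ V ≤ CF * Y ^ E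
  count-increasing Y Y≥1 z [] _ _ _ _ = 1^V≤CF*Y^E Y≥1
  count-increasing Y Y≥1 z (w ∷ ws) increasing kfull Y≤z spread≤Y with small-gap z w ws increasing
  ... | a , b , a∈ , b∈ , a<b , gaps = begin
    suc m ^ V                ≤⟨ [1+m]^n≤2^n*m^n V (s≤s z≤n) ⟩
    2 ^ V * m ^ V            ≤⟨ *-monoʳ-≤ (2 ^ V) (root-bound Y≥1 m-bound) ⟩
    2 ^ V * (K ^ V * Y ^ E)  ≡⟨ sym (*-assoc (2 ^ V) (K ^ V) (Y ^ E)) ⟩
    CF * Y ^ E               ∎
    where
    open ≤-Reasoning
    m : ℕ
    m = suc (length ws)
    Y≤b : Y ≤ b
    Y≤b = ≤-trans Y≤z (head≤ increasing b∈)
    gap-bound : b ^ f ≤ K * (b ∸ a) ^ (f + s)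
    gap-bound = kfull-gap-bound (≤-trans Y≥1 (≤-trans Y≤z (head≤ increasing a∈))) a<b
                  (All.lookup kfull a∈) (All.lookup kfull b∈)
    mD≤Y : m * (b ∸ a) ≤ Y
    mD≤Y = ≤-trans gaps spread≤Y
    m-bound : m ^ (f + s) ≤ K * Y ^ s
    m-bound = spacing-bound {K} {Y} {b} {b ∸ a} {m} f s Y≥1 Y≤b gap-bound mD≤Y

  InInterval : ℚ → ℚ → ℕ → Set
  InInterval x y n = x ℚ.< ⟦ n ⟧ × ⟦ n ⟧ ℚ.≤ x ℚ.+ y × KFull k n

  increasing-interval-count : ∀ x y → ℚ.1ℚ ℚ.≤ y → y ℚ.≤ x → ∀ zs → Linked _<_ zs →
    All (InInterval x y) zs → ⟦ length zs ⟧ ^ℚ V ℚ.≤ ⟦ CF ⟧ ℚ.* y ^ℚ E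
  increasing-interval-count x y 1≤y y≤x [] _ _ =
    ⟦⟧-^-bound {CF} {1} {0} V E 1≤y (≤-trans (^-monoˡ-≤ V (z≤n {1})) (1^V≤CF*Y^E ≤-refl))
  increasing-interval-count x y 1≤y y≤x (z ∷ ws) increasing in-interval =
    ⟦⟧-^-bound {CF} {Y} {suc (length ws)} V E Y≤y
      (count-increasing Y (m≤m⊔n 1 spread) z ws increasing (All.map (proj₂ ∘ proj₂) in-interval)
                        Y≤z (m≤n⊔m 1 spread))
    where
    x<z : x ℚ.< ⟦ z ⟧
    x<z = proj₁ (All.lookup in-interval (here refl))
    spread Y : ℕ
    spread = lastOf z ws ∸ z
    -- The spread is 0 for a single element, but the exponent bounds need Y ≥ 1.
    Y = 1 ⊔ spread
    last≤x+y : ⟦ lastOf z ws ⟧ ℚ.≤ x ℚ.+ y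
    last≤x+y = proj₁ (proj₂ (All.lookup in-interval (lastOf∈ z ws)))
    Y≤y : ⟦ Y ⟧ ℚ.≤ y
    Y≤y = ⟦⊔⟧≤ {1} {spread} 1≤y
            (⟦n∸m⟧≤ {x} {y} {z} {lastOf z ws} x<z last≤x+y (head≤ increasing (lastOf∈ z ws)))
    Y≤z : Y ≤ z
    Y≤z = <⇒≤ (⟦⟧-cancel-< (ℚP.≤-<-trans Y≤y (ℚP.≤-<-trans y≤x x<z)))

  kfull-interval-count : ∀ x y → ℚ.1ℚ ℚ.≤ y → y ℚ.≤ x → ∀ ns → KFullIn k x y ns →
    ⟦ length ns ⟧ ^ℚ V ℚ.≤ ⟦ CF ⟧ ℚ.* y ^ℚ E
  kfull-interval-count x y 1≤y y≤x ns (unique , in-interval) with increasing-permutation ns unique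
  ... | zs , zs↭ns , increasing rewrite sym (↭-length zs↭ns) =
    increasing-interval-count x y 1≤y y≤x zs increasing (All-resp-↭ (↭-sym zs↭ns) in-interval)

theorem4 : ABC → ∀ (k : ℕ) → 3 ℕ.≤ k → ∀ (u v : ℕ) → 1 ℕ.≤ u → 1 ℕ.≤ v →
    ∃ λ (C : ℕ) → ∀ (x y : ℚ) → ℚ.1ℚ ℚ.≤ x → ℚ.1ℚ ℚ.≤ y → y ℚ.≤ x →
      ∀ (ns : List ℕ) → KFullIn k x y ns →
        (⟦ length ns ⟧ ^ℚ (k ℕ.* v)) ℚ.≤ ⟦ C ⟧ ℚ.* (y ^ℚ (2 ℕ.* v ℕ.+ u))
theorem4 abc k k≥3 u v u≥1 v≥1 with abc⇒ABCBound abc (k * v) (*-mono-≤ (≤-trans (s≤s z≤n) k≥3) v≥1)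
... | C , abc-bound = CF , λ x y _ → kfull-interval-count x y
  where open Counting k v u C k≥3 u≥1 v≥1 abc-bound
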